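{- A finite simple graph $G$ is dismantlable if and only if its suspension $SG$ is dismantlable.
   Context: Graphs are finite, undirected, without loops or multiple edges. $N_G[g]$ denotes the closed neighbourhood of $g$. A vertex $g$ is dominated by $g'\ne g$ if $N_G[g]\subseteq N_G[g']$. A graph is dismantlable if it has exactly one vertex, or if its vertices can be listed $g_1,\dots,g_n$ ($n\ge 2$) so that each $g_i$ ($2\le i\le n$) is dominated by another vertex in the subgraph induced by $\{g_1,\dots,g_i\}$. The suspension $SG$ of $G$ is the graph with vertex set $V(G)\cup\{x,y\}$ ($x\ne y$ new vertices) and edge set $E(G)\cup\{xg: g\in V(G)\}\cup\{yg: g\in V(G)\}$ (in particular $x\not\sim y$). -}

module Defs where

open import Data.Nat using (ℕ; zero; suc; _≤_)
open import Data.Fin using (Fin; zero; suc; toℕ)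
open import Data.Bool using (Bool; true; false; T)
open import Data.Product using (Σ; _×_; _,_; ∃-syntax)
open import Data.Sum using (_⊎_)
open import Data.Empty using (⊥)
open import Relation.Nullary using (¬_)
open import Relation.Binary.PropositionalEquality using (_≡_; _≢_)
open import Function.Bundles using (_↔_; Inverse)

record Graph (n : ℕ) : Set where
  field
    adj   : Fin n → Fin n → Bool
    sym   : ∀ u v → adj u v ≡ adj v u
    irrefl : ∀ v → adj v v ≡ false
open Graph public

InN[_] : ∀ {n} → Graph n → Fin n → Fin n → Set
InN[ G ] v u = (u ≡ v) ⊎ T (adj G v u)

-- Given an ordering σ : Fin n ↔ Fin n of the vertices (σ i = g_{i+1}), the vertex
-- at position i is dominated, in the subgraph induced by the vertices at
-- positions 0..i, by the vertex at some position j ≤ i with j ≠ i.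
DominatedAt : ∀ {n} → Graph n → (Fin n ↔ Fin n) → Fin n → Set
DominatedAt {n} G σ i =
  ∃[ j ] (toℕ j ≤ toℕ i × j ≢ i ×
    (∀ (k : Fin n) → toℕ k ≤ toℕ i →
       InN[ G ] (f i) (f k) → InN[ G ] (f j) (f k)))
  where f = Inverse.to σ

-- Dismantlable: exactly one vertex, or n ≥ 2 and an ordering where each
-- g_i (i ≥ 2) is dominated in the induced subgraph on {g_1,…,g_i}.
-- (With n = 1 the ordering condition is vacuous, so both cases are covered by
-- requiring n ≥ 1 together with the ordering.)
Dismantlable : ∀ {n} → Graph n → Set
Dismantlable {n} G =
  1 ≤ n × Σ (Fin n ↔ Fin n) λ σ → ∀ (i : Fin n) → ¬ (toℕ i ≡ 0) → DominatedAt G σ i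

-- Suspension SG on Fin (suc (suc n)): zero = x, suc zero = y, suc (suc g) = g.
S-adj : ∀ {n} → Graph n → Fin (suc (suc n)) → Fin (suc (suc n)) → Bool
S-adj G zero zero = false
S-adj G zero (suc zero) = false
S-adj G zero (suc (suc _)) = true
S-adj G (suc zero) zero = false
S-adj G (suc zero) (suc zero) = false
S-adj G (suc zero) (suc (suc _)) = true
S-adj G (suc (suc _)) zero = true
S-adj G (suc (suc _)) (suc zero) = true
S-adj G (suc (suc u)) (suc (suc v)) = adj G u v

S-sym : ∀ {n} (G : Graph n) u v → S-adj G u v ≡ S-adj G v u
S-sym G zero zero = _≡_.refl
S-sym G zero (suc zero) = _≡_.refl
S-sym G zero (suc (suc _)) = _≡_.refl
S-sym G (suc zero) zero = _≡_.refl
S-sym G (suc zero) (suc zero) = _≡_.refl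
S-sym G (suc zero) (suc (suc _)) = _≡_.refl
S-sym G (suc (suc _)) zero = _≡_.refl
S-sym G (suc (suc _)) (suc zero) = _≡_.refl
S-sym G (suc (suc u)) (suc (suc v)) = sym G u v

S-irrefl : ∀ {n} (G : Graph n) v → S-adj G v v ≡ false
S-irrefl G zero = _≡_.refl
S-irrefl G (suc zero) = _≡_.refl
S-irrefl G (suc (suc v)) = irrefl G v

Susp : ∀ {n} → Graph n → Graph (suc (suc n))
Susp G = record { adj = S-adj G ; sym = S-sym G ; irrefl = S-irrefl G }

-- A dismantling order can be recorded by an injective rank on the vertices, not
-- necessarily consecutive; counting the vertices of smaller rank turns a rank back into
-- an order. A rank of G extends to SG by placing both poles right after the first vertex
-- g₀ of G: each pole then sees only g₀ among earlier vertices, so g₀ dominates it.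
-- Conversely, in a rank of SG the later pole is dominated by a vertex u of G, which is
-- therefore adjacent to every vertex of G ranked before that pole. Moving u to the front
-- gives a rank of G: vertices ranked before the pole are dominated by u, later ones by
-- their dominator in SG, which lies in G because it sees both poles.

module Submission where

open import Defs hiding (sym)
open import Data.Bool using (Bool; true; false)
open import Data.Bool.Properties using (T-≡)
open import Data.Fin using (Fin; zero; suc; toℕ; fromℕ<; punchOut)
open import Data.Fin.Properties
  using (_≟_; any?; toℕ-fromℕ<; toℕ-injective; suc-injective; punchOut-injective; injective⇒≤)
open import Data.Fin.Subset using (Subset; _∈_; _⊂_; ∣_∣; ⊤)
open import Data.Fin.Subset.Properties using (p⊂q⇒∣p∣<∣q∣; ∈⊤; ⊆⊤; ∣⊤∣≡n)
open import Data.Nat using (ℕ; zero; suc; _≤_; _<_; _<ᵇ_; z≤n; s≤s; _≤?_; s≤s⁻¹; _*_; pred)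
open import Data.Nat.Properties
  using (<ᵇ⇒<; <⇒<ᵇ; ≤-refl; ≤-reflexive; ≤-trans; <-trans; <⇒≤; <⇒≱; ≰⇒>; <-irrefl; 1+n≰n;
         n≤0⇒n≡0; m≤n⇒m<n∨m≡n; ≤-antisym; *-cancelʳ-≡; *-cancelʳ-≤; *-monoˡ-≤)
  renaming (_≟_ to _≟ℕ_)
open import Data.Product using (Σ; ∃; ∃-syntax; _×_; _,_; proj₁; proj₂)
open import Data.Sum using (_⊎_; inj₁; inj₂)
open import Data.Unit using (tt)
open import Data.Vec using (tabulate)
open import Data.Vec.Properties using (lookup∘tabulate; []=⇒lookup; lookup⇒[]=)
open import Function using (_∘_)
open import Function.Bundles using (_⇔_; _↔_; Inverse; Equivalence; mk⇔; mk↔ₛ′)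
open import Function.Definitions using (Injective)
open import Relation.Nullary using (¬_; yes; no; contradiction)
open import Relation.Binary.PropositionalEquality
  using (_≡_; _≢_; refl; sym; trans; cong; subst; subst₂)

private
  variable
    n : ℕ

injective⇒surjective : {f : Fin n → Fin n} → Injective _≡_ _≡_ f → ∀ y → ∃ λ x → f x ≡ y
injective⇒surjective {suc _} {f} f-injective y with any? (λ x → f x ≟ y)
... | yes hit = hit
... | no miss = contradiction (injective⇒≤ punchOut∘f-injective) 1+n≰n
  where
  y≢f : ∀ x → y ≢ f x
  y≢f x y≡fx = miss (x , sym y≡fx)
  punchOut∘f-injective : Injective _≡_ _≡_ (λ x → punchOut (y≢f x))
  punchOut∘f-injective e = f-injective (punchOut-injective (y≢f _) (y≢f _) e)

-- Its `from` is definitionally f, which `sorting` relies on.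
injective⇒↔ : {f : Fin n → Fin n} → Injective _≡_ _≡_ f → Fin n ↔ Fin n
injective⇒↔ {f = f} f-injective = mk↔ₛ′ preimage f
  (λ v → f-injective (proj₂ (surjective (f v))))
  (λ i → proj₂ (surjective i))
  where
  surjective = injective⇒surjective f-injective
  preimage : Fin _ → Fin _
  preimage = proj₁ ∘ surjective

position : Fin n ↔ Fin n → Fin n → ℕ
position σ = toℕ ∘ Inverse.from σ

module _ {r : Fin n → ℕ} (r-injective : Injective _≡_ _≡_ r) where

  below : Fin n → Subset n
  below v = tabulate (λ w → r w <ᵇ r v)

  ∈-below⁺ : ∀ {v w} → r w < r v → w ∈ below v
  ∈-below⁺ {v} {w} rw<rv =
    lookup⇒[]= w (below v) (trans (lookup∘tabulate _ w) (Equivalence.to T-≡ (<⇒<ᵇ rw<rv)))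

  ∈-below⁻ : ∀ {v w} → w ∈ below v → r w < r v
  ∈-below⁻ {v} {w} w∈ =
    <ᵇ⇒< (r w) (r v) (Equivalence.from T-≡ (trans (sym (lookup∘tabulate _ w)) ([]=⇒lookup w∈)))

  ∉-below-self : ∀ v → ¬ (v ∈ below v)
  ∉-below-self v v∈ = <-irrefl refl (∈-below⁻ v∈)

  below-⊂ : ∀ {v w} → r v < r w → below v ⊂ below w
  below-⊂ {v} rv<rw =
    (λ u∈ → ∈-below⁺ (<-trans (∈-below⁻ u∈) rv<rw)) , v , ∈-below⁺ rv<rw , ∉-below-self v

  ∣below∣<n : ∀ v → ∣ below v ∣ < n
  ∣below∣<n v = subst (∣ below v ∣ <_) (∣⊤∣≡n n) (p⊂q⇒∣p∣<∣q∣ (⊆⊤ , v , ∈⊤ , ∉-below-self v))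

  sortPosition : Fin n → Fin n
  sortPosition v = fromℕ< (∣below∣<n v)

  sortPosition-< : ∀ {v w} → r v < r w → toℕ (sortPosition v) < toℕ (sortPosition w)
  sortPosition-< {v} {w} rv<rw
    rewrite toℕ-fromℕ< (∣below∣<n v) | toℕ-fromℕ< (∣below∣<n w) = p⊂q⇒∣p∣<∣q∣ (below-⊂ rv<rw)

  sortPosition-≤⇔ : ∀ v w → r v ≤ r w ⇔ toℕ (sortPosition v) ≤ toℕ (sortPosition w)
  sortPosition-≤⇔ v w = mk⇔ mono reflect
    where
    mono : r v ≤ r w → toℕ (sortPosition v) ≤ toℕ (sortPosition w)
    mono rv≤rw with m≤n⇒m<n∨m≡n rv≤rw
    ... | inj₁ rv<rw = <⇒≤ (sortPosition-< rv<rw)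
    ... | inj₂ rv≡rw rewrite r-injective rv≡rw = ≤-refl
    reflect : toℕ (sortPosition v) ≤ toℕ (sortPosition w) → r v ≤ r w
    reflect pv≤pw with r v ≤? r w
    ... | yes rv≤rw = rv≤rw
    ... | no rv≰rw = contradiction pv≤pw (<⇒≱ (sortPosition-< (≰⇒> rv≰rw)))

  sortPosition-injective : Injective _≡_ _≡_ sortPosition
  sortPosition-injective {v} {w} pv≡pw = r-injective (≤-antisym
    (Equivalence.from (sortPosition-≤⇔ v w) (≤-reflexive (cong toℕ pv≡pw)))
    (Equivalence.from (sortPosition-≤⇔ w v) (≤-reflexive (cong toℕ (sym pv≡pw)))))

  sorting : Σ (Fin n ↔ Fin n) λ σ → ∀ v w → r v ≤ r w ⇔ position σ v ≤ position σ w
  sorting = injective⇒↔ sortPosition-injective , sortPosition-≤⇔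

DominatedBelow : Graph n → (Fin n → ℕ) → Fin n → Set
DominatedBelow G r v =
  ∃[ w ] (w ≢ v × r w ≤ r v × (∀ k → r k ≤ r v → InN[ G ] v k → InN[ G ] w k))

record DismantlingRank (G : Graph n) (r : Fin n → ℕ) : Set where
  field
    injective : Injective _≡_ _≡_ r
    root      : Fin n
    root-rank : r root ≡ 0
    dominated : ∀ v → r v ≡ 0 ⊎ DominatedBelow G r v

open DismantlingRank

DominatedBelow-resp : ∀ {G : Graph n} {r s} → (∀ v w → r v ≤ r w ⇔ s v ≤ s w) →
                      ∀ {v} → DominatedBelow G r v → DominatedBelow G s v
DominatedBelow-resp r≈s {v} (w , w≢v , rw≤rv , N[v]⊆N[w]) =
  w , w≢v , Equivalence.to (r≈s w v) rw≤rv ,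
  λ k sk≤sv → N[v]⊆N[w] k (Equivalence.from (r≈s k v) sk≤sv)

module _ (σ : Fin n ↔ Fin n) where
  open Inverse σ using (to; from; strictlyInverseˡ; strictlyInverseʳ)

  to-injective : Injective _≡_ _≡_ to
  to-injective {i} {j} e = trans (sym (strictlyInverseʳ i)) (trans (cong from e) (strictlyInverseʳ j))

  from-injective : Injective _≡_ _≡_ from
  from-injective {v} {w} e = trans (sym (strictlyInverseˡ v)) (trans (cong to e) (strictlyInverseˡ w))

  position∘to : ∀ i → position σ (to i) ≡ toℕ i
  position∘to i = cong toℕ (strictlyInverseʳ i)

  dominatedAt⇒dominatedBelow : ∀ {G : Graph n} {i} → DominatedAt G σ i → DominatedBelow G (position σ) (to i)
  dominatedAt⇒dominatedBelow {G} {i} (j , j≤i , j≢i , N[i]⊆N[j]) =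
    to j , j≢i ∘ to-injective , subst₂ _≤_ (sym (position∘to j)) (sym (position∘to i)) j≤i ,
    λ k k≤i N[i]k → subst (InN[ G ] (to j)) (strictlyInverseˡ k)
      (N[i]⊆N[j] (from k) (subst (toℕ (from k) ≤_) (position∘to i) k≤i)
        (subst (InN[ G ] (to i)) (sym (strictlyInverseˡ k)) N[i]k))

  dominatedBelow⇒dominatedAt : ∀ {G : Graph n} {i} → DominatedBelow G (position σ) (to i) → DominatedAt G σ i
  dominatedBelow⇒dominatedAt {G} {i} (w , w≢i , w≤i , N[i]⊆N[w]) =
    from w , subst (position σ w ≤_) (position∘to i) w≤i ,
    (λ e → w≢i (from-injective (trans e (sym (strictlyInverseʳ i))))) ,
    λ k k≤i N[i]k → subst (λ u → InN[ G ] u (to k)) (sym (strictlyInverseˡ w))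
      (N[i]⊆N[w] (to k) (subst₂ _≤_ (sym (position∘to k)) (sym (position∘to i)) k≤i) N[i]k)

dismantlable⇒rank : {G : Graph n} → Dismantlable G → ∃ (DismantlingRank G)
dismantlable⇒rank {suc _} {G} (_ , σ , dominatedAt) = position σ , record
  { injective = from-injective σ ∘ toℕ-injective
  ; root      = to zero
  ; root-rank = cong toℕ (strictlyInverseʳ zero)
  ; dominated = dominated′
  }
  where
  open Inverse σ using (to; from; strictlyInverseˡ; strictlyInverseʳ)
  dominated′ : ∀ v → position σ v ≡ 0 ⊎ DominatedBelow G (position σ) v
  dominated′ v with position σ v ≟ℕ 0
  ... | yes first = inj₁ first
  ... | no later = inj₂ (subst (DominatedBelow G (position σ)) (strictlyInverseˡ v)
                          (dominatedAt⇒dominatedBelow σ {G} (dominatedAt (from v) later)))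

rank⇒dismantlable : {G : Graph n} → ∃ (DismantlingRank G) → Dismantlable G
rank⇒dismantlable {suc _} {G} (r , ρ) = s≤s z≤n , σ , dominatedAt
  where
  σ = proj₁ (sorting (injective ρ))
  r≈position = proj₂ (sorting (injective ρ))
  open Inverse σ using (to; strictlyInverseʳ)
  dominatedAt : ∀ i → ¬ (toℕ i ≡ 0) → DominatedAt G σ i
  dominatedAt i i≢0 with dominated ρ (to i)
  ... | inj₂ below = dominatedBelow⇒dominatedAt σ {G} (DominatedBelow-resp {G = G} r≈position below)
  ... | inj₁ first = contradiction (n≤0⇒n≡0 i≤0) i≢0
    where
    i≤0 : toℕ i ≤ 0
    i≤0 = subst₂ _≤_ (cong toℕ (strictlyInverseʳ i)) (cong toℕ (strictlyInverseʳ zero))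
      (Equivalence.to (r≈position (to i) (to zero)) (subst (_≤ r (to zero)) (sym first) z≤n))

pattern north = zero
pattern south = suc zero
pattern base g = suc (suc g)

module _ (G : Graph n) where

  InN-base⁺ : ∀ {v k} → InN[ G ] v k → InN[ Susp G ] (base v) (base k)
  InN-base⁺ (inj₁ k≡v) = inj₁ (cong (λ g → base g) k≡v)
  InN-base⁺ (inj₂ v~k) = inj₂ v~k

  InN-base⁻ : ∀ {v k} → InN[ Susp G ] (base v) (base k) → InN[ G ] v k
  InN-base⁻ (inj₁ k≡v) = inj₁ (suc-injective (suc-injective k≡v))
  InN-base⁻ (inj₂ v~k) = inj₂ v~k

  sees-both-poles : ∀ {w} → InN[ Susp G ] w north → InN[ Susp G ] w south → ∃ λ g → w ≡ base g
  sees-both-poles {north} _ (inj₁ ())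
  sees-both-poles {north} _ (inj₂ ())
  sees-both-poles {south} (inj₁ ()) _
  sees-both-poles {south} (inj₂ ()) _
  sees-both-poles {base g} _ _ = g , refl

-- Scaling by 3 makes room for the poles right after the root of G, which has rank 0.
suspendRank : (Fin n → ℕ) → Fin (suc (suc n)) → ℕ
suspendRank r north    = 1
suspendRank r south    = 2
suspendRank r (base g) = r g * 3

m*3≢1 : ∀ m → m * 3 ≢ 1
m*3≢1 zero    ()
m*3≢1 (suc m) ()

m*3≢2 : ∀ m → m * 3 ≢ 2
m*3≢2 zero    ()
m*3≢2 (suc m) ()

m*3≤2⇒m≡0 : ∀ {m} → m * 3 ≤ 2 → m ≡ 0
m*3≤2⇒m≡0 {zero}  _              = refl
m*3≤2⇒m≡0 {suc m} (s≤s (s≤s ()))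

suspendRank-injective : {r : Fin n → ℕ} → Injective _≡_ _≡_ r → Injective _≡_ _≡_ (suspendRank r)
suspendRank-injective _ {north} {north} _ = refl
suspendRank-injective _ {south} {south} _ = refl
suspendRank-injective _ {north} {south} ()
suspendRank-injective _ {south} {north} ()
suspendRank-injective {r = r} _ {north}  {base g} e = contradiction (sym e) (m*3≢1 (r g))
suspendRank-injective {r = r} _ {south}  {base g} e = contradiction (sym e) (m*3≢2 (r g))
suspendRank-injective {r = r} _ {base g} {north}  e = contradiction e (m*3≢1 (r g))
suspendRank-injective {r = r} _ {base g} {south}  e = contradiction e (m*3≢2 (r g))
suspendRank-injective {r = r} r-injective {base g} {base h} e =
  cong (λ v → base v) (r-injective (*-cancelʳ-≡ (r g) (r h) 3 e))

suspension-rank⁺ : {G : Graph n} → ∃ (DismantlingRank G) → ∃ (DismantlingRank (Susp G))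
suspension-rank⁺ {G = G} (r , ρ) = suspendRank r , record
  { injective = suspendRank-injective (injective ρ)
  ; root      = base (root ρ)
  ; root-rank = cong (_* 3) (root-rank ρ)
  ; dominated = dominated′
  }
  where
  R = suspendRank r
  o = root ρ

  only-root-below-poles : ∀ g → r g * 3 ≤ 2 → g ≡ o
  only-root-below-poles g le = injective ρ (trans (m*3≤2⇒m≡0 le) (sym (root-rank ρ)))

  root-≤ : ∀ m → R (base o) ≤ m
  root-≤ m = subst (λ k → k * 3 ≤ m) (sym (root-rank ρ)) z≤n

  north-dominated : ∀ k → R k ≤ 1 → InN[ Susp G ] north k → InN[ Susp G ] (base o) k
  north-dominated north    _  _ = inj₂ tt
  north-dominated south    (s≤s ()) _
  north-dominated (base g) le _ = inj₁ (cong (λ v → base v) (only-root-below-poles g (≤-trans le (s≤s z≤n))))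

  south-dominated : ∀ k → R k ≤ 2 → InN[ Susp G ] south k → InN[ Susp G ] (base o) k
  south-dominated north    _  (inj₁ ())
  south-dominated north    _  (inj₂ ())
  south-dominated south    _  _ = inj₂ tt
  south-dominated (base g) le _ = inj₁ (cong (λ v → base v) (only-root-below-poles g le))

  dominated′ : ∀ v → R v ≡ 0 ⊎ DominatedBelow (Susp G) R v
  dominated′ north = inj₂ (base o , (λ ()) , root-≤ 1 , north-dominated)
  dominated′ south = inj₂ (base o , (λ ()) , root-≤ 2 , south-dominated)
  dominated′ (base v) with dominated ρ v
  ... | inj₁ rv≡0 = inj₁ (cong (_* 3) rv≡0)
  ... | inj₂ (w , w≢v , rw≤rv , N[v]⊆N[w]) =
    inj₂ (base w , w≢v ∘ suc-injective ∘ suc-injective , *-monoˡ-≤ 3 rw≤rv , N[base-v]⊆N[base-w])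
    where
    N[base-v]⊆N[base-w] : ∀ k → R k ≤ R (base v) → InN[ Susp G ] (base v) k → InN[ Susp G ] (base w) k
    N[base-v]⊆N[base-w] north    _  _ = inj₂ tt
    N[base-v]⊆N[base-w] south    _  _ = inj₂ tt
    N[base-v]⊆N[base-w] (base k) le N[v]k =
      InN-base⁺ G (N[v]⊆N[w] k (*-cancelʳ-≤ (r k) (r v) 3 le) (InN-base⁻ G N[v]k))

promote : Fin n → (Fin n → ℕ) → Fin n → ℕ
promote u s g with g ≟ u
... | yes _ = 0
... | no  _ = suc (s g)

module _ {u : Fin n} {s : Fin n → ℕ} where

  promote-self : promote u s u ≡ 0
  promote-self with u ≟ u
  ... | yes _   = refl
  ... | no  u≢u = contradiction refl u≢u

  promote-injective : Injective _≡_ _≡_ s → Injective _≡_ _≡_ (promote u s)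
  promote-injective s-injective {v} {w} e with v ≟ u | w ≟ u
  ... | yes v≡u | yes w≡u = trans v≡u (sym w≡u)
  ... | no  _   | no  _   = s-injective (cong pred e)
  promote-injective _ () | yes _ | no _
  promote-injective _ () | no _  | yes _

  promote-≤⁺ : ∀ {k m} → s k ≤ m → promote u s k ≤ suc m
  promote-≤⁺ {k} sk≤m with k ≟ u
  ... | yes _ = z≤n
  ... | no  _ = s≤s sk≤m

  promote-≤⁻ : ∀ {k m} → promote u s k ≤ suc m → k ≡ u ⊎ s k ≤ m
  promote-≤⁻ {k} le with k ≟ u
  ... | yes k≡u = inj₁ k≡u
  ... | no  _   = inj₂ (s≤s⁻¹ le)

pole : Bool → Fin (suc (suc n))
pole false = north
pole true  = south

module _ (G : Graph n) where

  pole-adjacent : ∀ b g → InN[ Susp G ] (pole b) (base g)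
  pole-adjacent false _ = inj₂ tt
  pole-adjacent true  _ = inj₂ tt

  neighbour-of-pole : ∀ b {w} → w ≢ pole b → InN[ Susp G ] w (pole b) → ∃ λ g → w ≡ base g
  neighbour-of-pole false {north}  w≢p _ = contradiction refl w≢p
  neighbour-of-pole false {south}  _ (inj₁ ())
  neighbour-of-pole false {south}  _ (inj₂ ())
  neighbour-of-pole true  {north}  _ (inj₁ ())
  neighbour-of-pole true  {north}  _ (inj₂ ())
  neighbour-of-pole true  {south}  w≢p _ = contradiction refl w≢p
  neighbour-of-pole _     {base g} _ _ = g , refl

record Apex (G : Graph n) (R : Fin (suc (suc n)) → ℕ) : Set where
  field
    height    : ℕ
    vertex    : Fin n
    north-≤   : R north ≤ height
    south-≤   : R south ≤ height
    vertex-≤  : R (base vertex) ≤ height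
    universal : ∀ g → R (base g) ≤ height → InN[ G ] vertex g

open Apex

module _ {G : Graph n} {R : Fin (suc (suc n)) → ℕ} (ρ : DismantlingRank (Susp G) R) where

  apexAtPole : ∀ b → R north ≤ R (pole b) → R south ≤ R (pole b) → Apex G R
  apexAtPole b north≤p south≤p with dominated ρ (pole b)
  ... | inj₁ p≡0 = contradiction
        (injective ρ (trans (n≤0⇒n≡0 (subst (R north ≤_) p≡0 north≤p))
                            (sym (n≤0⇒n≡0 (subst (R south ≤_) p≡0 south≤p)))))
        (λ ())
  ... | inj₂ (w , w≢p , w≤p , N[p]⊆N[w])
    with neighbour-of-pole G b w≢p (N[p]⊆N[w] (pole b) ≤-refl (inj₁ refl))
  ... | u , refl = record
    { height    = R (pole b)
    ; vertex    = u
    ; north-≤   = north≤p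
    ; south-≤   = south≤p
    ; vertex-≤  = w≤p
    ; universal = λ g g≤p → InN-base⁻ G (N[p]⊆N[w] (base g) g≤p (pole-adjacent G b g))
    }

  apex : Apex G R
  apex with R north ≤? R south
  ... | yes north≤south = apexAtPole true north≤south ≤-refl
  ... | no  north≰south = apexAtPole false ≤-refl (<⇒≤ (≰⇒> north≰south))

  apex-rank : (a : Apex G R) → DismantlingRank G (promote (vertex a) (R ∘ base))
  apex-rank a = record
    { injective = promote-injective (suc-injective ∘ suc-injective ∘ injective ρ)
    ; root      = u
    ; root-rank = promote-self
    ; dominated = dominated′
    }
    where
    u = vertex a
    r = promote u (R ∘ base)

    dominated′ : ∀ g → r g ≡ 0 ⊎ DominatedBelow G r g
    dominated′ g with g ≟ u
    ... | yes _   = inj₁ refl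
    ... | no  g≢u with R (base g) ≤? height a
    ...   | yes low = inj₂ (u , g≢u ∘ sym , subst (_≤ _) (sym promote-self) z≤n , N[g]⊆N[u])
      where
      N[g]⊆N[u] : ∀ k → r k ≤ suc (R (base g)) → InN[ G ] g k → InN[ G ] u k
      N[g]⊆N[u] k le _ with promote-≤⁻ le
      ... | inj₁ k≡u = inj₁ k≡u
      ... | inj₂ k≤g = universal a k (≤-trans k≤g low)
    ...   | no  high with dominated ρ (base g)
    ...     | inj₁ g≡0 = contradiction (subst (height a <_) g≡0 (≰⇒> high)) (λ ())
    ...     | inj₂ (w , w≢g , w≤g , N[g]⊆N[w])
      with sees-both-poles G (N[g]⊆N[w] north (above (north-≤ a)) (inj₂ tt))
                             (N[g]⊆N[w] south (above (south-≤ a)) (inj₂ tt))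
      where
      above : ∀ {m} → m ≤ height a → m ≤ R (base g)
      above m≤h = ≤-trans m≤h (<⇒≤ (≰⇒> high))
    ...     | w′ , refl = inj₂ (w′ , w≢g ∘ cong (λ v → base v) , promote-≤⁺ w≤g , N[g]⊆N[w′])
      where
      N[g]⊆N[w′] : ∀ k → r k ≤ suc (R (base g)) → InN[ G ] g k → InN[ G ] w′ k
      N[g]⊆N[w′] k le N[g]k = InN-base⁻ G (N[g]⊆N[w] (base k) k≤g (InN-base⁺ G N[g]k))
        where
        k≤g : R (base k) ≤ R (base g)
        k≤g with promote-≤⁻ le
        ... | inj₁ refl = ≤-trans (vertex-≤ a) (<⇒≤ (≰⇒> high))
        ... | inj₂ k≤g′ = k≤g′

suspension-rank⁻ : {G : Graph n} → ∃ (DismantlingRank (Susp G)) → ∃ (DismantlingRank G)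
suspension-rank⁻ (R , ρ) = _ , apex-rank ρ (apex ρ)

proposition1p4 : ∀ (n : ℕ) (G : Graph n) → Dismantlable G ⇔ Dismantlable (Susp G)
proposition1p4 n G = mk⇔
  (rank⇒dismantlable ∘ suspension-rank⁺ ∘ dismantlable⇒rank)
  (rank⇒dismantlable ∘ suspension-rank⁻ ∘ dismantlable⇒rank)
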